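{- Let $\psi_1,\psi_3$ be the morphisms of $\{0,1\}^*$ given by $\psi_1(0)=01,\ \psi_1(1)=0$ and $\psi_3(0)=0,\ \psi_3(1)=01$, and let $\mathcal{M}_{1,3}$ be the monoid (under composition) generated by $\psi_1$ and $\psi_3$. Then for every $\psi\in\mathcal{M}_{1,3}$ the finite words $01\,\psi^2(0)$ and $10\,\psi^2(1)$ are palindromes.
   Context: A palindrome is a finite word equal to its own reversal. -}

module Defs where

open import Data.List using (List; []; _∷_; _++_; reverse; concatMap)
open import Relation.Binary.PropositionalEquality using (_≡_)

data Bit : Set where
  b0 b1 : Bit

Word : Set
Word = List Bit

-- A morphism of {0,1}^* is determined by the images of the letters.
Morphism : Set
Morphism = Bit → Word

apply : Morphism → Word → Word
apply φ w = concatMap φ w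

_∘ₘ_ : Morphism → Morphism → Morphism
(φ ∘ₘ χ) a = apply φ (χ a)

idₘ : Morphism
idₘ a = a ∷ []

ψ₁ : Morphism
ψ₁ b0 = b0 ∷ b1 ∷ []
ψ₁ b1 = b0 ∷ []

ψ₃ : Morphism
ψ₃ b0 = b0 ∷ []
ψ₃ b1 = b0 ∷ b1 ∷ []

data M₁₃ : Morphism → Set where
  m-id  : M₁₃ idₘ
  m-ψ₁  : M₁₃ ψ₁
  m-ψ₃  : M₁₃ ψ₃
  m-∘   : ∀ {φ χ} → M₁₃ φ → M₁₃ χ → M₁₃ (φ ∘ₘ χ)

IsPalindrome : Word → Set
IsPalindrome w = reverse w ≡ w

module Submission where

-- Call a morphism ψ of {0,1}* *palindromic* (record Palindromic)
-- if there are a palindrome q (the centre) and a bit c (the parity) with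
--   (i)   ψ(a) q = q ψ(a)ᴿ                 for each letter a,
--   (ii)  ψ(a ā) = q (a⊕c)(a⊕c)‾           for each letter a,
--   (iii) (a⊕c)(a⊕c)‾ ψ(a) is a palindrome for each letter a,
-- where ā is the complementary letter and ⊕ is addition mod 2.
-- The identity, ψ₁ and ψ₃ are palindromic by inspection, and the class is
-- closed under composition (centre φ(q_χ) q_φ, parity c_χ ⊕ c_φ), so every
-- ψ ∈ M₁₃ is palindromic.  For ψ² the parity is c ⊕ c = 0, and (iii) for ψ²
-- is exactly the theorem.
-- The composition step rests on general facts about a morphism φ with
-- property (i): images of palindromes followed by q are palindromes, and
-- (iii) transfers along φ once the common border q is stripped off.

open import Defs
open import Data.List using (List; []; _∷_; _++_; reverse)
open import Data.List.Properties
  using (concatMap-++; reverse-++; reverse-involutive; ++-assoc; ++-identityʳ; ++-cancelˡ; ++-cancelʳ)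
open import Data.Product using (_×_; _,_)
open import Relation.Binary.PropositionalEquality
open ≡-Reasoning

flip : Bit → Bit
flip b0 = b1
flip b1 = b0

infixl 6 _⊕_
_⊕_ : Bit → Bit → Bit
b0 ⊕ c = c
b1 ⊕ c = flip c

⊕-identityʳ : ∀ a → a ⊕ b0 ≡ a
⊕-identityʳ b0 = refl
⊕-identityʳ b1 = refl

⊕-assoc : ∀ a b c → a ⊕ b ⊕ c ≡ a ⊕ (b ⊕ c)
⊕-assoc b0 b c = refl
⊕-assoc b1 b0 c = refl
⊕-assoc b1 b1 b0 = refl
⊕-assoc b1 b1 b1 = refl

⊕-self : ∀ a → a ⊕ a ≡ b0
⊕-self b0 = refl
⊕-self b1 = refl

pair : Bit → Word
pair a = a ∷ flip a ∷ []

palindrome-strip : {A : Set} (q x : List A) → reverse q ≡ q →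
                   reverse (q ++ x ++ q) ≡ q ++ x ++ q → reverse x ≡ x
palindrome-strip q x q-pal qxq-pal =
  ++-cancelʳ q (reverse x) x (++-cancelˡ q _ _ (begin
    q ++ reverse x ++ q                    ≡⟨ cong₂ (λ l r → l ++ reverse x ++ r) (sym q-pal) (sym q-pal) ⟩
    reverse q ++ reverse x ++ reverse q    ≡⟨ sym (++-assoc (reverse q) _ _) ⟩
    (reverse q ++ reverse x) ++ reverse q  ≡⟨ cong (_++ reverse q) (sym (reverse-++ x q)) ⟩
    reverse (x ++ q) ++ reverse q          ≡⟨ sym (reverse-++ q (x ++ q)) ⟩
    reverse (q ++ x ++ q)                  ≡⟨ qxq-pal ⟩
    q ++ x ++ q                            ∎))

apply-letter : ∀ φ a → apply φ (a ∷ []) ≡ φ a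
apply-letter φ a = ++-identityʳ (φ a)

apply-∘ : ∀ φ χ w → apply (φ ∘ₘ χ) w ≡ apply φ (apply χ w)
apply-∘ φ χ [] = refl
apply-∘ φ χ (x ∷ w) = begin
  apply φ (χ x) ++ apply (φ ∘ₘ χ) w     ≡⟨ cong (apply φ (χ x) ++_) (apply-∘ φ χ w) ⟩
  apply φ (χ x) ++ apply φ (apply χ w)  ≡⟨ sym (concatMap-++ φ (χ x) _) ⟩
  apply φ (χ x ++ apply χ w)            ∎

mirror : Morphism → Morphism
mirror φ a = reverse (φ a)

reverse-apply : ∀ φ w → reverse (apply φ w) ≡ apply (mirror φ) (reverse w)
reverse-apply φ [] = refl
reverse-apply φ (x ∷ w) = begin
  reverse (φ x ++ apply φ w)                      ≡⟨ reverse-++ (φ x) (apply φ w) ⟩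
  reverse (apply φ w) ++ reverse (φ x)            ≡⟨ cong₂ _++_ (reverse-apply φ w) (sym (apply-letter (mirror φ) x)) ⟩
  apply (mirror φ) (reverse w) ++ apply (mirror φ) (x ∷ [])
                                                  ≡⟨ sym (concatMap-++ (mirror φ) (reverse w) (x ∷ [])) ⟩
  apply (mirror φ) (reverse w ++ x ∷ [])          ≡⟨ cong (apply (mirror φ)) (sym (reverse-++ (x ∷ []) w)) ⟩
  apply (mirror φ) (reverse (x ∷ w))              ∎

Conjugates : Morphism → Word → Set
Conjugates φ q = ∀ a → φ a ++ q ≡ q ++ reverse (φ a)

conjugate-apply : ∀ φ q → Conjugates φ q → ∀ w → apply φ w ++ q ≡ q ++ apply (mirror φ) w
conjugate-apply φ q conj [] = sym (++-identityʳ q)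
conjugate-apply φ q conj (x ∷ w) = begin
  (φ x ++ apply φ w) ++ q                  ≡⟨ ++-assoc (φ x) (apply φ w) q ⟩
  φ x ++ (apply φ w ++ q)                  ≡⟨ cong (φ x ++_) (conjugate-apply φ q conj w) ⟩
  φ x ++ (q ++ apply (mirror φ) w)         ≡⟨ sym (++-assoc (φ x) q _) ⟩
  (φ x ++ q) ++ apply (mirror φ) w         ≡⟨ cong (_++ apply (mirror φ) w) (conj x) ⟩
  (q ++ reverse (φ x)) ++ apply (mirror φ) w ≡⟨ ++-assoc q _ _ ⟩
  q ++ apply (mirror φ) (x ∷ w)            ∎

conjugate-reverse : ∀ φ q → Conjugates φ q → ∀ w → apply φ w ++ q ≡ q ++ reverse (apply φ (reverse w))
conjugate-reverse φ q conj w = begin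
  apply φ w ++ q                               ≡⟨ conjugate-apply φ q conj w ⟩
  q ++ apply (mirror φ) w                      ≡⟨ cong (λ v → q ++ apply (mirror φ) v) (sym (reverse-involutive w)) ⟩
  q ++ apply (mirror φ) (reverse (reverse w))  ≡⟨ cong (q ++_) (sym (reverse-apply φ (reverse w))) ⟩
  q ++ reverse (apply φ (reverse w))           ∎

palindrome-image : ∀ φ q → IsPalindrome q → Conjugates φ q →
                   ∀ w → IsPalindrome w → IsPalindrome (apply φ w ++ q)
palindrome-image φ q q-pal conj w w-pal = begin
  reverse (apply φ w ++ q)              ≡⟨ reverse-++ (apply φ w) q ⟩
  reverse q ++ reverse (apply φ w)      ≡⟨ cong₂ _++_ q-pal (reverse-apply φ w) ⟩
  q ++ apply (mirror φ) (reverse w)     ≡⟨ cong (λ v → q ++ apply (mirror φ) v) w-pal ⟩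
  q ++ apply (mirror φ) w               ≡⟨ sym (conjugate-apply φ q conj w) ⟩
  apply φ w ++ q                        ∎

-- If u w is a palindrome and φ(u) = q v, then v φ(w) is a palindrome:
-- φ(u w) q = q (v φ(w)) q is a palindrome, and the border q can be stripped.
palindrome-transfer : ∀ φ q → IsPalindrome q → Conjugates φ q →
                      ∀ u v w → IsPalindrome (u ++ w) → apply φ u ≡ q ++ v →
                      IsPalindrome (v ++ apply φ w)
palindrome-transfer φ q q-pal conj u v w uw-pal φu≡qv =
  palindrome-strip q (v ++ apply φ w) q-pal
    (subst IsPalindrome bordered (palindrome-image φ q q-pal conj (u ++ w) uw-pal))
  where
  bordered : apply φ (u ++ w) ++ q ≡ q ++ (v ++ apply φ w) ++ q
  bordered = begin
    apply φ (u ++ w) ++ q               ≡⟨ cong (_++ q) (concatMap-++ φ u w) ⟩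
    (apply φ u ++ apply φ w) ++ q       ≡⟨ cong (λ t → (t ++ apply φ w) ++ q) φu≡qv ⟩
    ((q ++ v) ++ apply φ w) ++ q        ≡⟨ cong (_++ q) (++-assoc q v (apply φ w)) ⟩
    (q ++ v ++ apply φ w) ++ q          ≡⟨ ++-assoc q _ q ⟩
    q ++ (v ++ apply φ w) ++ q          ∎

record Palindromic (ψ : Morphism) : Set where
  field
    centre       : Word
    parity       : Bit
    centre-pal   : IsPalindrome centre
    conjugate    : Conjugates ψ centre
    on-pair      : ∀ a → apply ψ (pair a) ≡ centre ++ pair (a ⊕ parity)
    prefixed-pal : ∀ a → IsPalindrome (pair (a ⊕ parity) ++ ψ a)

palindromic-id : Palindromic idₘ
palindromic-id = record
  { centre = [] ; parity = b0 ; centre-pal = refl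
  ; conjugate    = λ { b0 → refl ; b1 → refl }
  ; on-pair      = λ { b0 → refl ; b1 → refl }
  ; prefixed-pal = λ { b0 → refl ; b1 → refl } }

palindromic-ψ₁ : Palindromic ψ₁
palindromic-ψ₁ = record
  { centre = b0 ∷ [] ; parity = b1 ; centre-pal = refl
  ; conjugate    = λ { b0 → refl ; b1 → refl }
  ; on-pair      = λ { b0 → refl ; b1 → refl }
  ; prefixed-pal = λ { b0 → refl ; b1 → refl } }

palindromic-ψ₃ : Palindromic ψ₃
palindromic-ψ₃ = record
  { centre = b0 ∷ [] ; parity = b0 ; centre-pal = refl
  ; conjugate    = λ { b0 → refl ; b1 → refl }
  ; on-pair      = λ { b0 → refl ; b1 → refl }
  ; prefixed-pal = λ { b0 → refl ; b1 → refl } }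

palindromic-∘ : ∀ {φ χ} → Palindromic φ → Palindromic χ → Palindromic (φ ∘ₘ χ)
palindromic-∘ {φ} {χ} Pφ Pχ = record
  { centre = q ; parity = c ; centre-pal = q-pal
  ; conjugate = conj ; on-pair = pair-image ; prefixed-pal = pal }
  where
  module F = Palindromic Pφ
  module X = Palindromic Pχ

  q : Word
  q = apply φ X.centre ++ F.centre

  c : Bit
  c = X.parity ⊕ F.parity

  q-pal : IsPalindrome q
  q-pal = palindrome-image φ F.centre F.centre-pal F.conjugate X.centre X.centre-pal

  conj : Conjugates (φ ∘ₘ χ) q
  conj a = begin
    apply φ (χ a) ++ apply φ X.centre ++ F.centre          ≡⟨ sym (++-assoc (apply φ (χ a)) _ F.centre) ⟩
    (apply φ (χ a) ++ apply φ X.centre) ++ F.centre        ≡⟨ cong (_++ F.centre) (sym (concatMap-++ φ (χ a) X.centre)) ⟩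
    apply φ (χ a ++ X.centre) ++ F.centre                  ≡⟨ cong (λ v → apply φ v ++ F.centre) (X.conjugate a) ⟩
    apply φ (X.centre ++ reverse (χ a)) ++ F.centre        ≡⟨ cong (_++ F.centre) (concatMap-++ φ X.centre _) ⟩
    (apply φ X.centre ++ apply φ (reverse (χ a))) ++ F.centre
                                                           ≡⟨ ++-assoc (apply φ X.centre) _ F.centre ⟩
    apply φ X.centre ++ apply φ (reverse (χ a)) ++ F.centre
                                                           ≡⟨ cong (apply φ X.centre ++_) (conjugate-reverse φ F.centre F.conjugate (reverse (χ a))) ⟩
    apply φ X.centre ++ F.centre ++ reverse (apply φ (reverse (reverse (χ a))))
                                                           ≡⟨ cong (λ v → apply φ X.centre ++ F.centre ++ reverse (apply φ v)) (reverse-involutive (χ a)) ⟩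
    apply φ X.centre ++ F.centre ++ reverse (apply φ (χ a)) ≡⟨ sym (++-assoc (apply φ X.centre) F.centre _) ⟩
    q ++ reverse (apply φ (χ a))                           ∎
  
  pair-image : ∀ a → apply (φ ∘ₘ χ) (pair a) ≡ q ++ pair (a ⊕ c)
  pair-image a = begin
    apply (φ ∘ₘ χ) (pair a)                                   ≡⟨ apply-∘ φ χ (pair a) ⟩
    apply φ (apply χ (pair a))                                ≡⟨ cong (apply φ) (X.on-pair a) ⟩
    apply φ (X.centre ++ pair (a ⊕ X.parity))                 ≡⟨ concatMap-++ φ X.centre _ ⟩
    apply φ X.centre ++ apply φ (pair (a ⊕ X.parity))         ≡⟨ cong (apply φ X.centre ++_) (F.on-pair (a ⊕ X.parity)) ⟩
    apply φ X.centre ++ F.centre ++ pair (a ⊕ X.parity ⊕ F.parity)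
                                                              ≡⟨ sym (++-assoc (apply φ X.centre) F.centre _) ⟩
    q ++ pair (a ⊕ X.parity ⊕ F.parity)                       ≡⟨ cong (λ b → q ++ pair b) (⊕-assoc a X.parity F.parity) ⟩
    q ++ pair (a ⊕ c)                                         ∎

  pal : ∀ a → IsPalindrome (pair (a ⊕ c) ++ apply φ (χ a))
  pal a = subst (λ b → IsPalindrome (pair b ++ apply φ (χ a))) (⊕-assoc a X.parity F.parity)
    (palindrome-transfer φ F.centre F.centre-pal F.conjugate
      (pair (a ⊕ X.parity)) (pair (a ⊕ X.parity ⊕ F.parity)) (χ a)
      (X.prefixed-pal a) (F.on-pair (a ⊕ X.parity)))

palindromic : ∀ {ψ} → M₁₃ ψ → Palindromic ψ
palindromic m-id       = palindromic-id
palindromic m-ψ₁       = palindromic-ψ₁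
palindromic m-ψ₃       = palindromic-ψ₃
palindromic (m-∘ m m') = palindromic-∘ (palindromic m) (palindromic m')

-- For ψ ∈ M₁₃, the square ψ² is palindromic with parity c ⊕ c = 0,
-- so property (iii) of ψ² says that 01 ψ²(0) and 10 ψ²(1) are palindromes.
lemma2 : ∀ ψ → M₁₃ ψ →
    IsPalindrome (b0 ∷ b1 ∷ apply ψ (apply ψ (b0 ∷ [])))
      × IsPalindrome (b1 ∷ b0 ∷ apply ψ (apply ψ (b1 ∷ [])))
lemma2 ψ m = square-pal b0 , square-pal b1
  where
  c : Bit
  c = Palindromic.parity (palindromic m)

  open Palindromic (palindromic-∘ (palindromic m) (palindromic m))

  parity-zero : ∀ a → a ⊕ (c ⊕ c) ≡ a
  parity-zero a = trans (cong (a ⊕_) (⊕-self c)) (⊕-identityʳ a)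

  square-pal : ∀ a → IsPalindrome (pair a ++ apply ψ (apply ψ (a ∷ [])))
  square-pal a = subst IsPalindrome
    (cong₂ (λ b w → pair b ++ apply ψ w) (parity-zero a) (sym (apply-letter ψ a)))
    (prefixed-pal a)
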